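{- Let $\nabla$ be a freshness environment over $\Sigma$ and let $\varphi$ be a ground substitution. Then $\varphi(\nabla)$ holds iff $\varphi(\mathrm{nf}(\nabla))$ holds. Moreover, $\varphi(\mathrm{nf}(\nabla))$ holds iff $\varphi(\widetilde{\mathrm{nf}}(\nabla))$ holds.
   Context: Atoms: disjoint countably infinite sets $\mathbb{A}_\alpha$, $\mathbb{A}=\bigcup\mathbb{A}_\alpha$; permutations: sort-preserving bijections moving finitely many atoms. Nominal sets, support, freshness $a\#s$ ($a\notin\mathrm{supp}(s)$), and atom abstraction $\langle a\rangle s=\{(b,(b\ a)\cdot s)\mid b=a\text{ or } b\#s\}$ are as usual in nominal set theory. Renamings: sort-preserving maps $\rho:\mathbb{A}\to\mathbb{A}$ fixing all but finitely many atoms; $\rho_1;\rho_2=\rho_2\circ\rho_1$; $\iota$ identity. Over a nominal signature $\Sigma$ (base sorts $\delta_1,\ldots,\delta_n$, function symbols $f_{ij}:\sigma_{ij}\to\delta_i$), raw terms are variables $x$, atoms, moderated terms $\mathrm{mod}(t,\rho)$, abstractions $[a]t$, tuples, $f(t)$. Renaming action: $x[\rho]=x$, $a[\rho]=\rho(a)$, $\mathrm{mod}(t,\rho_1)[\rho]=\mathrm{mod}(t,\rho_1;\rho)$, $([a]t)[\rho]=[\rho(a)](t[\rho])$, componentwise otherwise. Substitutions are sort-preserving finitely supported maps from variables to raw terms, extended by $\varphi(a)=a$, $\varphi(\mathrm{mod}(t,\rho))=\mathrm{mod}(\varphi(t),\rho)$, $\varphi([a]t)=[a]\varphi(t)$,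 homomorphically otherwise; ground if every $\varphi(x)\ne x$ is ground. Nominal terms: ground $p$ denotes $[\![p]\!]$ with $[\![a]\!]=a$, $[\![\mathrm{mod}(p,\rho)]\!]=[\![p[\rho]]\!]$, $[\![[a]p]\!]=\langle a\rangle[\![p]\!]$, tuples componentwise, $[\![f_{ij}(p)]\!]=\mathrm{inj}_j[\![p]\!]$ into the least solution of $\mathrm{NT}(\delta_i)=\sum_j\mathrm{NT}(\sigma_{ij})$ (with $\mathrm{NT}(\alpha)=\mathbb{A}_\alpha$, $\mathrm{NT}([\alpha]\sigma)=[\mathbb{A}_\alpha]\mathrm{NT}(\sigma)$, products). A freshness environment is a finite set of assertions $a\not\approx t$; $\varphi(\nabla)$ holds iff $a\#[\![\varphi(t)]\!]$ for every $a\not\approx t\in\nabla$ (it is understood that all such $\varphi(t)$ are ground). Simplification $\Rightarrow$: $\{a\not\approx b\}\cup\nabla\Rightarrow\nabla$ ($a\ne b$); $\{a\not\approx\mathrm{mod}(b,\rho)\}\cup\nabla\Rightarrow\{a\not\approx\rho(b)\}\cup\nabla$; $\{a\not\approx\mathrm{mod}(\mathrm{mod}(t,\rho_1),\rho)\}\cup\nabla\Rightarrow\{a\not\approx\mathrm{mod}(t,\rho_1;\rho)\}\cup\nabla$; $\{a\not\approx\mathrm{mod}([b]t,\rho)\}\cup\nabla\Rightarrow\{a\not\approx[\rho(b)]\mathrm{mod}(t,\rho)\}\cup\nabla$; $\{a\not\approx\mathrm{mod}((t_1,\ldots,t_k),\rho)\}\cup\nabla\Rightarrow\{a\not\approx\mathrm{mod}(t_l,\rho)\}_{l}\cup\nabla$;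 $\{a\not\approx\mathrm{mod}(f(t),\rho)\}\cup\nabla\Rightarrow\{a\not\approx\mathrm{mod}(t,\rho)\}\cup\nabla$; $\{a\not\approx[b]t\}\cup\nabla\Rightarrow\{a\not\approx t\}\cup\nabla$ if $a\ne b$, $\Rightarrow\nabla$ if $a=b$; $\{a\not\approx(t_1,\ldots,t_k)\}\cup\nabla\Rightarrow\{a\not\approx t_l\}_l\cup\nabla$; $\{a\not\approx f(t)\}\cup\nabla\Rightarrow\{a\not\approx t\}\cup\nabla$. This relation is confluent and terminating; $\mathrm{nf}(\nabla)$ is the unique normal form (consisting of reduced assertions $a\not\approx a$, $a\not\approx x$, $a\not\approx\mathrm{mod}(x,\rho)$), and $\widetilde{\mathrm{nf}}(\nabla)$ is obtained from $\mathrm{nf}(\nabla)$ by replacing each $a\not\approx x$ by $a\not\approx\mathrm{mod}(x,\iota)$. -}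

module Defs where

open import Data.Nat using (ℕ)
import Data.Nat as Nat
open import Data.Fin using (Fin)
open import Data.Bool using (Bool; true; false; if_then_else_; _∧_)
open import Data.List using (List; []; _∷_; _++_; map; [_])
open import Data.List.Membership.Propositional using (_∈_; _∉_)
open import Data.List.Membership.Propositional.Properties using (∈-++⁺ˡ; ∈-++⁺ʳ)
open import Data.List.Relation.Unary.All using (All)
open import Data.Product using (Σ; _×_; _,_; ∃; proj₁; proj₂)
import Data.Product.Properties as ProdP
open import Relation.Binary.PropositionalEquality hiding ([_])
open import Relation.Binary.Definitions using (DecidableEquality)
open import Relation.Binary.Construct.Closure.ReflexiveTransitive using (Star)
open import Relation.Nullary using (¬_; yes; no; does)

data Sort (ASort : Set) (nB : ℕ) : Set where
  atm  : ASort → Sort ASort nB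
  base : Fin nB → Sort ASort nB
  abs  : ASort → Sort ASort nB → Sort ASort nB
  prod : List (Sort ASort nB) → Sort ASort nB

-- A nominal signature Σ: atom sorts (with decidable equality),
-- base sorts δ_1,…,δ_n (as Fin n), and for every base sort δ_i
-- finitely many function symbols f_ij : σ_ij → δ_i  (j : Fin (nF i)).
record Signature : Set₁ where
  field
    ASort : Set
    _≟A_  : DecidableEquality ASort
    nB    : ℕ
    nF    : Fin nB → ℕ
    arity : (i : Fin nB) → Fin (nF i) → Sort ASort nB

module Nominal (S : Signature) where
  open Signature S

  Srt : Set
  Srt = Sort ASort nB

  -- Atoms: 𝔸 = ⋃ 𝔸_α, with 𝔸_α = {α} × ℕ countably infinite, disjoint.
  Atom : Set
  Atom = Σ ASort (λ _ → ℕ)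

  _≟At_ : DecidableEquality Atom
  _≟At_ = ProdP.≡-dec _≟A_ Nat._≟_

  record Renaming : Set where
    field
      ren    : ASort → ℕ → ℕ
      moved  : List Atom
      finite : ∀ α n → (α , n) ∉ moved → ren α n ≡ n
  open Renaming public

  ι : Renaming
  ι = record { ren = λ _ n → n ; moved = [] ; finite = λ _ _ _ → refl }

  _⨾_ : Renaming → Renaming → Renaming
  ρ₁ ⨾ ρ₂ = record
    { ren = λ α n → ren ρ₂ α (ren ρ₁ α n)
    ; moved = moved ρ₁ ++ moved ρ₂
    ; finite = λ α n n∉ →
        trans (cong (ren ρ₂ α) (finite ρ₁ α n (λ m → n∉ (∈-++⁺ˡ m))))
              (finite ρ₂ α n (λ m → n∉ (∈-++⁺ʳ (moved ρ₁) m)))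
    }

  record Perm : Set where
    field
      fwd    : ASort → ℕ → ℕ
      bwd    : ASort → ℕ → ℕ
      bwd∘fwd : ∀ α n → bwd α (fwd α n) ≡ n
      fwd∘bwd : ∀ α n → fwd α (bwd α n) ≡ n
      pmoved : List Atom
      pfinite : ∀ α n → (α , n) ∉ pmoved → fwd α n ≡ n
  open Perm public

  _$ₚ_ : Perm → Atom → Atom
  π $ₚ (α , n) = α , fwd π α n

  mutual
    data Term : Srt → Set where
      var  : ∀ {σ} → ℕ → Term σ
      atom : ∀ {α} → ℕ → Term (atm α)
      mod  : ∀ {σ} → Term σ → Renaming → Term σ
      abst : ∀ {α σ} → ℕ → Term σ → Term (abs α σ)
      tup  : ∀ {σs} → Terms σs → Term (prod σs)
      fun  : ∀ {i} (j : Fin (nF i)) → Term (arity i j) → Term (base i)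

    data Terms : List Srt → Set where
      []  : Terms []
      _∷_ : ∀ {σ σs} → Term σ → Terms σs → Terms (σ ∷ σs)

  mutual
    data Ground : ∀ {σ} → Term σ → Set where
      gatom : ∀ {α n} → Ground (atom {α} n)
      gmod  : ∀ {σ} {t : Term σ} {ρ} → Ground t → Ground (mod t ρ)
      gabst : ∀ {α σ n} {t : Term σ} → Ground t → Ground (abst {α} n t)
      gtup  : ∀ {σs} {ts : Terms σs} → Grounds ts → Ground (tup ts)
      gfun  : ∀ {i j} {t : Term (arity i j)} → Ground t → Ground (fun j t)

    data Grounds : ∀ {σs} → Terms σs → Set where
      []  : Grounds []
      _∷_ : ∀ {σ σs} {t : Term σ} {ts : Terms σs} → Ground t → Grounds ts → Grounds (t ∷ ts)

  record Subst : Set where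
    field
      sub    : (σ : Srt) → ℕ → Term σ
      dom    : List (Σ Srt (λ _ → ℕ))
      sfinite : ∀ σ x → (σ , x) ∉ dom → sub σ x ≡ var x
  open Subst public

  IsGroundSubst : Subst → Set
  IsGroundSubst φ = ∀ σ x → sub φ σ x ≢ var x → Ground (sub φ σ x)

  mutual
    _⟪_⟫ : ∀ {σ} → Subst → Term σ → Term σ
    φ ⟪ var {σ} x ⟫  = sub φ σ x
    φ ⟪ atom a ⟫     = atom a
    φ ⟪ mod t ρ ⟫    = mod (φ ⟪ t ⟫) ρ
    φ ⟪ abst a t ⟫   = abst a (φ ⟪ t ⟫)
    φ ⟪ tup ts ⟫     = tup (φ ⟪ ts ⟫s)
    φ ⟪ fun j t ⟫    = fun j (φ ⟪ t ⟫)

    _⟪_⟫s : ∀ {σs} → Subst → Terms σs → Terms σs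
    φ ⟪ [] ⟫s     = []
    φ ⟪ t ∷ ts ⟫s = (φ ⟪ t ⟫) ∷ (φ ⟪ ts ⟫s)

  -- The nominal sets NT(σ): least solution, realised concretely as
  -- sorted trees modulo α-equivalence (setoid equality _≈_).
  mutual
    data Val : Srt → Set where
      vatom : ∀ {α} → ℕ → Val (atm α)
      vabs  : ∀ {α σ} → ℕ → Val σ → Val (abs α σ)
      vtup  : ∀ {σs} → Vals σs → Val (prod σs)
      vinj  : ∀ {i} (j : Fin (nF i)) → Val (arity i j) → Val (base i)

    data Vals : List Srt → Set where
      []  : Vals []
      _∷_ : ∀ {σ σs} → Val σ → Vals σs → Vals (σ ∷ σs)

  mutual
    mapV : ∀ {σ} → (ASort → ℕ → ℕ) → Val σ → Val σ
    mapV f (vatom {α} n)  = vatom (f α n)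
    mapV f (vabs {α} n v) = vabs (f α n) (mapV f v)
    mapV f (vtup vs)      = vtup (mapVs f vs)
    mapV f (vinj j v)     = vinj j (mapV f v)

    mapVs : ∀ {σs} → (ASort → ℕ → ℕ) → Vals σs → Vals σs
    mapVs f []       = []
    mapVs f (v ∷ vs) = mapV f v ∷ mapVs f vs

  _·_ : ∀ {σ} → Perm → Val σ → Val σ
  π · v = mapV (fwd π) v

  swap : ASort → ℕ → ℕ → ASort → ℕ → ℕ
  swap α a c β n with does (β ≟A α)
  ... | false = n
  ... | true  = if does (n Nat.≟ a) then c else (if does (n Nat.≟ c) then a else n)

  mutual
    atomsV : ∀ {σ} → Val σ → List Atom
    atomsV (vatom {α} n)  = (α , n) ∷ []
    atomsV (vabs {α} n v) = (α , n) ∷ atomsV v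
    atomsV (vtup vs)      = atomsVs vs
    atomsV (vinj j v)     = atomsV v

    atomsVs : ∀ {σs} → Vals σs → List Atom
    atomsVs []       = []
    atomsVs (v ∷ vs) = atomsV v ++ atomsVs vs

  -- α-equivalence: equality of NT(σ); ⟨a⟩v = ⟨b⟩w iff (a c)·v = (b c)·w
  -- for some (equivalently every) c not occurring in a, b, v, w.
  mutual
    data _≈_ : ∀ {σ} → Val σ → Val σ → Set where
      atom≈ : ∀ {α n} → vatom {α} n ≈ vatom n
      abs≈  : ∀ {α σ a b} {v w : Val σ} (c : ℕ) →
              (α , c) ∉ ((α , a) ∷ (α , b) ∷ atomsV v ++ atomsV w) →
              mapV (swap α a c) v ≈ mapV (swap α b c) w →
              vabs {α} a v ≈ vabs {α} b w
      tup≈  : ∀ {σs} {vs ws : Vals σs} → vs ≈s ws → vtup vs ≈ vtup ws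
      inj≈  : ∀ {i j} {v w : Val (arity i j)} → v ≈ w → vinj j v ≈ vinj j w

    data _≈s_ : ∀ {σs} → Vals σs → Vals σs → Set where
      []  : [] ≈s []
      _∷_ : ∀ {σ σs} {v w : Val σ} {vs ws : Vals σs} → v ≈ w → vs ≈s ws → (v ∷ vs) ≈s (w ∷ ws)

  -- support and freshness (nominal sets): S supports v if every
  -- permutation fixing S pointwise fixes v; supp(v) is the intersection
  -- of all finite supports, so a # v iff a avoids some finite support.
  Supports : ∀ {σ} → List Atom → Val σ → Set
  Supports As v = ∀ (π : Perm) → (∀ a → a ∈ As → π $ₚ a ≡ a) → (π · v) ≈ v

  _#_ : ∀ {σ} → Atom → Val σ → Set
  a # v = ∃ λ (As : List Atom) → a ∉ As × Supports As v

  -- Denotation of ground terms.  den ρ p = ⟦ p[ρ] ⟧  (the renaming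
  -- pushed in by ⟦mod(p,ρ)⟧ = ⟦p[ρ]⟧ is accumulated), ⟦ p ⟧ = den ι p.
  mutual
    den : ∀ {σ} → Renaming → (t : Term σ) → Ground t → Val σ
    den ρ (atom {α} n)   gatom     = vatom (ren ρ α n)
    den ρ (mod t ρ₁)     (gmod g)  = den (ρ₁ ⨾ ρ) t g
    den ρ (abst {α} n t) (gabst g) = vabs (ren ρ α n) (den ρ t g)
    den ρ (tup ts)       (gtup gs) = vtup (dens ρ ts gs)
    den ρ (fun j t)      (gfun g)  = vinj j (den ρ t g)

    dens : ∀ {σs} → Renaming → (ts : Terms σs) → Grounds ts → Vals σs
    dens ρ []       []       = []
    dens ρ (t ∷ ts) (g ∷ gs) = den ρ t g ∷ dens ρ ts gs

  ⟦_⟧ : ∀ {σ} → (t : Term σ) → Ground t → Val σ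
  ⟦ t ⟧ g = den ι t g

  data Assertion : Set where
    _≉_ : ∀ {σ} → Atom → Term σ → Assertion

  FEnv : Set
  FEnv = List Assertion

  HoldsA : Subst → Assertion → Set
  HoldsA φ (a ≉ t) = (g : Ground (φ ⟪ t ⟫)) → a # ⟦ φ ⟪ t ⟫ ⟧ g

  Holds : Subst → FEnv → Set
  Holds φ ∇ = All (HoldsA φ) ∇

  GroundOn : Subst → FEnv → Set
  GroundOn φ ∇ = All (λ { (a ≉ t) → Ground (φ ⟪ t ⟫) }) ∇

  modAll : ∀ {σs} → Atom → Renaming → Terms σs → FEnv
  modAll a ρ []       = []
  modAll a ρ (t ∷ ts) = (a ≉ mod t ρ) ∷ modAll a ρ ts

  splitAll : ∀ {σs} → Atom → Terms σs → FEnv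
  splitAll a []       = []
  splitAll a (t ∷ ts) = (a ≉ t) ∷ splitAll a ts

  data _⟶_ : Assertion → FEnv → Set where
    r-atom    : ∀ {a α b} → a ≢ (α , b) → (a ≉ atom {α} b) ⟶ []
    r-modatom : ∀ {a α b ρ} → (a ≉ mod (atom {α} b) ρ) ⟶ [ a ≉ atom {α} (ren ρ α b) ]
    r-modmod  : ∀ {a σ} {t : Term σ} {ρ₁ ρ} → (a ≉ mod (mod t ρ₁) ρ) ⟶ [ a ≉ mod t (ρ₁ ⨾ ρ) ]
    r-modabs  : ∀ {a α σ b} {t : Term σ} {ρ} →
                (a ≉ mod (abst {α} b t) ρ) ⟶ [ a ≉ abst {α} (ren ρ α b) (mod t ρ) ]
    r-modtup  : ∀ {a σs} {ts : Terms σs} {ρ} → (a ≉ mod (tup ts) ρ) ⟶ modAll a ρ ts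
    r-modfun  : ∀ {a i j} {t : Term (arity i j)} {ρ} → (a ≉ mod (fun j t) ρ) ⟶ [ a ≉ mod t ρ ]
    r-abs≢    : ∀ {a α σ b} {t : Term σ} → a ≢ (α , b) → (a ≉ abst {α} b t) ⟶ [ a ≉ t ]
    r-abs≡    : ∀ {a α σ b} {t : Term σ} → a ≡ (α , b) → (a ≉ abst {α} b t) ⟶ []
    r-tup     : ∀ {a σs} {ts : Terms σs} → (a ≉ tup ts) ⟶ splitAll a ts
    r-fun     : ∀ {a i j} {t : Term (arity i j)} → (a ≉ fun j t) ⟶ [ a ≉ t ]

  -- {A} ∪ ∇ ⇒ R ∪ ∇   (environments as lists)
  data _⇒_ : FEnv → FEnv → Set where
    step : ∀ ∇₁ {A R} ∇₂ → A ⟶ R → (∇₁ ++ A ∷ ∇₂) ⇒ (∇₁ ++ R ++ ∇₂)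

  IsNF : FEnv → FEnv → Set
  IsNF ∇ N = Star _⇒_ ∇ N × (∀ N′ → ¬ (N ⇒ N′))

  tildeT : ∀ {σ} → Term σ → Term σ
  tildeT (var x) = mod (var x) ι
  tildeT t       = t

  tilde : FEnv → FEnv
  tilde = map (λ { (a ≉ t) → a ≉ tildeT t })

open Nominal public

-- Each simplification rule replaces an assertion a ≉ t by assertions that, under a ground
-- substitution, hold exactly when it does.  The rules on atoms, abstractions, tuples and
-- function symbols are the freshness laws a # b (a ≠ b), a # ⟨a⟩v, a # ⟨b⟩v ⇔ a # v (a ≠ b)
-- and componentwise freshness in products and injections; the rules pushing mod inwards are
-- equations ⟦mod(p, ρ)⟧ = ⟦p[ρ]⟧, which the denotation satisfies by construction.  The laws
-- for abstractions rest on α-equivalence being preserved by injective renamings of atoms.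
-- So φ(∇) is invariant along ⇒*, and ñf only inserts mod(x, ι), which denotes what x does.
module Submission where

open import Data.Nat using (ℕ; suc)
import Data.Nat as ℕ
open import Data.Nat.Properties using (≤-totalOrder; <-irrefl)
open import Data.List using (List; []; _∷_; _++_; [_]; map; filter)
open import Data.List.Properties using (map-++)
open import Data.List.Extrema ≤-totalOrder using (max; xs≤max)
open import Data.List.Membership.Propositional using (_∈_; _∉_)
open import Data.List.Membership.Propositional.Properties
  using (∈-++⁺ˡ; ∈-++⁺ʳ; ∈-++⁻; ∈-map⁺; ∈-map⁻; ∈-filter⁺; ∈-filter⁻)
open import Data.List.Relation.Unary.Any using (here; there)
open import Data.List.Relation.Unary.All as All using (All; []; _∷_)
import Data.List.Relation.Unary.All.Properties as AllP
open import Data.Product using (∃; _×_; _,_; proj₁; proj₂; uncurry)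
open import Data.Product.Function.NonDependent.Propositional using (_×-⇔_)
open import Data.Sum using ([_,_]′)
open import Data.Empty using (⊥-elim)
open import Function using (_∘_)
open import Function.Bundles using (_⇔_; mk⇔; Equivalence)
import Function.Properties.Equivalence as ⇔
open import Function.Definitions using (Injective)
open import Relation.Binary.PropositionalEquality hiding ([_])
open import Function.Related.Propositional using (module EquationalReasoning; ≡⇒; equivalence)
open import Relation.Binary.Construct.Closure.ReflexiveTransitive using (Star; ε; _◅_)
open import Relation.Nullary using (yes; no; ¬?)
open import Relation.Nullary.Decidable using (dec-true; dec-false)
open import Defs using (Signature; module Nominal)

module _ {a p} {A : Set a} {P : A → Set p} where

  All-replace : ∀ xs {x ys zs} → (P x → All P zs) → All P (xs ++ x ∷ ys) → All P (xs ++ zs ++ ys)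
  All-replace []       f (px ∷ pys) = AllP.++⁺ (f px) pys
  All-replace (_ ∷ xs) f (p ∷ ps)   = p ∷ All-replace xs f ps

  All-replace⁻ : ∀ xs {x ys} zs → (All P zs → P x) → All P (xs ++ zs ++ ys) → All P (xs ++ x ∷ ys)
  All-replace⁻ []       zs f ps       = f (AllP.++⁻ˡ zs ps) ∷ AllP.++⁻ʳ zs ps
  All-replace⁻ (_ ∷ xs) zs f (p ∷ ps) = p ∷ All-replace⁻ xs zs f ps

∉-map⁺ : ∀ {a b} {A : Set a} {B : Set b} {f : A → B} {x xs} →
         Injective _≡_ _≡_ f → x ∉ xs → f x ∉ map f xs
∉-map⁺ f-inj x∉ fx∈ with ∈-map⁻ _ fx∈
... | y , y∈ , fx≡fy = x∉ (subst (_∈ _) (sym (f-inj fx≡fy)) y∈)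

-- Opaque: only the existence of c matters, and unfolding max stalls type checking.
opaque
  fresh : ∀ {a} {A : Set a} (α : A) (xs : List (A × ℕ)) → ∃ λ c → (α , c) ∉ xs
  fresh α xs = suc (max 0 (map proj₂ xs)) , λ c∈ →
    <-irrefl refl (All.lookup (xs≤max 0 (map proj₂ xs)) (∈-map⁺ proj₂ c∈))

module _ (S : Signature) where
  open Signature S
  open Nominal S

  onAtom : (ASort → ℕ → ℕ) → Atom → Atom
  onAtom f (β , n) = β , f β n

  SortwiseInjective : (ASort → ℕ → ℕ) → Set
  SortwiseInjective f = ∀ β → Injective _≡_ _≡_ (f β)

  onAtom-injective : ∀ {f} → SortwiseInjective f → Injective _≡_ _≡_ (onAtom f)
  onAtom-injective f-inj {β , m} {γ , n} eq with cong proj₁ eq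
  ... | refl = cong (β ,_) (f-inj β (cong proj₂ eq))

  fwd-injective : ∀ π → SortwiseInjective (fwd π)
  fwd-injective π α {m} {n} eq = begin
    m                      ≡⟨ bwd∘fwd π α m ⟨
    bwd π α (fwd π α m)    ≡⟨ cong (bwd π α) eq ⟩
    bwd π α (fwd π α n)    ≡⟨ bwd∘fwd π α n ⟩
    n                      ∎
    where open ≡-Reasoning

  fwd-fixed : ∀ {π As α b} → (∀ x → x ∈ As → π $ₚ x ≡ x) → (α , b) ∈ As → fwd π α b ≡ b
  fwd-fixed fix b∈ = cong proj₂ (fix _ b∈)

  swap-left : ∀ α a c → swap α a c α a ≡ c
  swap-left α a c with α ≟A α
  ... | no α≢α = ⊥-elim (α≢α refl)
  ... | yes _ rewrite dec-true (a ℕ.≟ a) refl = refl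

  swap-right : ∀ α a c → swap α a c α c ≡ a
  swap-right α a c with α ≟A α
  ... | no α≢α = ⊥-elim (α≢α refl)
  ... | yes _ with c ℕ.≟ a
  ...   | yes c≡a rewrite dec-true (c ℕ.≟ a) c≡a = c≡a
  ...   | no c≢a rewrite dec-false (c ℕ.≟ a) c≢a | dec-true (c ℕ.≟ c) refl = refl

  swap-fixes : ∀ {α a c β n} → (β , n) ≢ (α , a) → (β , n) ≢ (α , c) → swap α a c β n ≡ n
  swap-fixes {α} {a} {c} {β} {n} ≢a ≢c with β ≟A α
  ... | no _ = refl
  ... | yes refl rewrite dec-false (n ℕ.≟ a) (≢a ∘ cong (α ,_))
                       | dec-false (n ℕ.≟ c) (≢c ∘ cong (α ,_)) = refl

  swap-involutive : ∀ α a c β n → swap α a c β (swap α a c β n) ≡ n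
  swap-involutive α a c β n with (β , n) ≟At (α , a) | (β , n) ≟At (α , c)
  ... | yes refl | _      = trans (cong (swap α a c α) (swap-left α a c)) (swap-right α a c)
  ... | no _     | yes refl = trans (cong (swap α a c α) (swap-right α a c)) (swap-left α a c)
  ... | no ≢a    | no ≢c  = trans (cong (swap α a c β) (swap-fixes ≢a ≢c)) (swap-fixes ≢a ≢c)

  swap-injective : ∀ α a c → SortwiseInjective (swap α a c)
  swap-injective α a c β {m} {n} eq =
    trans (sym (swap-involutive α a c β m)) (trans (cong (swap α a c β) eq) (swap-involutive α a c β n))

  swap-conjugate : ∀ {f} → SortwiseInjective f → ∀ α a c β n →
                   swap α (f α a) (f α c) β (f β n) ≡ f β (swap α a c β n)
  swap-conjugate {f} f-inj α a c β n with (β , n) ≟At (α , a) | (β , n) ≟At (α , c)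
  ... | yes refl | _        = trans (swap-left α (f α a) (f α c)) (cong (f α) (sym (swap-left α a c)))
  ... | no _     | yes refl = trans (swap-right α (f α a) (f α c)) (cong (f α) (sym (swap-right α a c)))
  ... | no ≢a    | no ≢c    = trans (swap-fixes (≢a ∘ onAtom-injective f-inj) (≢c ∘ onAtom-injective f-inj))
                                    (cong (f β) (sym (swap-fixes ≢a ≢c)))

  mutual
    mapV-cong : ∀ {σ} {f g : ASort → ℕ → ℕ} (v : Val σ) →
                (∀ β n → (β , n) ∈ atomsV v → f β n ≡ g β n) → mapV f v ≡ mapV g v
    mapV-cong (vatom {α} n)  f≗g = cong vatom (f≗g α n (here refl))
    mapV-cong (vabs {α} n v) f≗g = cong₂ vabs (f≗g α n (here refl)) (mapV-cong v λ β m → f≗g β m ∘ there)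
    mapV-cong (vtup vs)      f≗g = cong vtup (mapVs-cong vs f≗g)
    mapV-cong (vinj j v)     f≗g = cong (vinj j) (mapV-cong v f≗g)

    mapVs-cong : ∀ {σs} {f g : ASort → ℕ → ℕ} (vs : Vals σs) →
                 (∀ β n → (β , n) ∈ atomsVs vs → f β n ≡ g β n) → mapVs f vs ≡ mapVs g vs
    mapVs-cong []       f≗g = refl
    mapVs-cong (v ∷ vs) f≗g = cong₂ _∷_ (mapV-cong v λ β n → f≗g β n ∘ ∈-++⁺ˡ)
                                        (mapVs-cong vs λ β n → f≗g β n ∘ ∈-++⁺ʳ (atomsV v))

  mutual
    mapV-∘ : ∀ {σ} (f g : ASort → ℕ → ℕ) (v : Val σ) → mapV g (mapV f v) ≡ mapV (λ β → g β ∘ f β) v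
    mapV-∘ f g (vatom n)  = refl
    mapV-∘ f g (vabs n v) = cong (vabs _) (mapV-∘ f g v)
    mapV-∘ f g (vtup vs)  = cong vtup (mapVs-∘ f g vs)
    mapV-∘ f g (vinj j v) = cong (vinj j) (mapV-∘ f g v)

    mapVs-∘ : ∀ {σs} (f g : ASort → ℕ → ℕ) (vs : Vals σs) → mapVs g (mapVs f vs) ≡ mapVs (λ β → g β ∘ f β) vs
    mapVs-∘ f g []       = refl
    mapVs-∘ f g (v ∷ vs) = cong₂ _∷_ (mapV-∘ f g v) (mapVs-∘ f g vs)

  mutual
    mapV-id : ∀ {σ} (v : Val σ) → mapV (λ _ n → n) v ≡ v
    mapV-id (vatom n)  = refl
    mapV-id (vabs n v) = cong (vabs n) (mapV-id v)
    mapV-id (vtup vs)  = cong vtup (mapVs-id vs)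
    mapV-id (vinj j v) = cong (vinj j) (mapV-id v)

    mapVs-id : ∀ {σs} (vs : Vals σs) → mapVs (λ _ n → n) vs ≡ vs
    mapVs-id []       = refl
    mapVs-id (v ∷ vs) = cong₂ _∷_ (mapV-id v) (mapVs-id vs)

  mutual
    atomsV-mapV : ∀ {σ} f (v : Val σ) → atomsV (mapV f v) ≡ map (onAtom f) (atomsV v)
    atomsV-mapV f (vatom n)  = refl
    atomsV-mapV f (vabs n v) = cong (_ ∷_) (atomsV-mapV f v)
    atomsV-mapV f (vtup vs)  = atomsVs-mapVs f vs
    atomsV-mapV f (vinj j v) = atomsV-mapV f v

    atomsVs-mapVs : ∀ {σs} f (vs : Vals σs) → atomsVs (mapVs f vs) ≡ map (onAtom f) (atomsVs vs)
    atomsVs-mapVs f []       = refl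
    atomsVs-mapVs f (v ∷ vs) =
      trans (cong₂ _++_ (atomsV-mapV f v) (atomsVs-mapVs f vs)) (sym (map-++ (onAtom f) (atomsV v) (atomsVs vs)))

  mapV-swap-conjugate : ∀ {σ f} → SortwiseInjective f → ∀ α a c (v : Val σ) →
                        mapV (swap α (f α a) (f α c)) (mapV f v) ≡ mapV f (mapV (swap α a c) v)
  mapV-swap-conjugate {f = f} f-inj α a c v = begin
    mapV (swap α (f α a) (f α c)) (mapV f v)          ≡⟨ mapV-∘ f _ v ⟩
    mapV (λ β → swap α (f α a) (f α c) β ∘ f β) v     ≡⟨ mapV-cong v (λ β n _ → swap-conjugate f-inj α a c β n) ⟩
    mapV (λ β → f β ∘ swap α a c β) v                 ≡⟨ mapV-∘ (swap α a c) f v ⟨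
    mapV f (mapV (swap α a c) v)                      ∎
    where open ≡-Reasoning

  mapV-swap-involutive : ∀ {σ} α a c (v : Val σ) → mapV (swap α a c) (mapV (swap α a c) v) ≡ v
  mapV-swap-involutive α a c v = begin
    mapV (swap α a c) (mapV (swap α a c) v)          ≡⟨ mapV-∘ (swap α a c) (swap α a c) v ⟩
    mapV (λ β → swap α a c β ∘ swap α a c β) v       ≡⟨ mapV-cong v (λ β n _ → swap-involutive α a c β n) ⟩
    mapV (λ _ n → n) v                               ≡⟨ mapV-id v ⟩
    v                                                ∎
    where open ≡-Reasoning

  mutual
    mapV-≈ : ∀ {σ f} {v w : Val σ} → SortwiseInjective f → v ≈ w → mapV f v ≈ mapV f w
    mapV-≈ f-inj atom≈ = atom≈
    mapV-≈ {f = f} f-inj (abs≈ {α} {a = a} {b} {v} {w} c c∉ v≈w) =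
      abs≈ (f α c) fc∉ (subst₂ _≈_ (sym (mapV-swap-conjugate f-inj α a c v))
                                   (sym (mapV-swap-conjugate f-inj α b c w))
                                   (mapV-≈ f-inj v≈w))
      where
        fc∉ : (α , f α c) ∉ ((α , f α a) ∷ (α , f α b) ∷ atomsV (mapV f v) ++ atomsV (mapV f w))
        fc∉ rewrite atomsV-mapV f v | atomsV-mapV f w | sym (map-++ (onAtom f) (atomsV v) (atomsV w))
          = ∉-map⁺ (onAtom-injective f-inj) c∉
    mapV-≈ f-inj (tup≈ vs≈ws) = tup≈ (mapVs-≈ f-inj vs≈ws)
    mapV-≈ f-inj (inj≈ v≈w)   = inj≈ (mapV-≈ f-inj v≈w)

    mapVs-≈ : ∀ {σs f} {vs ws : Vals σs} → SortwiseInjective f → vs ≈s ws → mapVs f vs ≈s mapVs f ws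
    mapVs-≈ f-inj []           = []
    mapVs-≈ f-inj (v≈w ∷ vs≈ws) = mapV-≈ f-inj v≈w ∷ mapVs-≈ f-inj vs≈ws

  -- Reflexivity must be proved for all images mapV f v at once: the abstraction case
  -- recurses on a swapped body.
  mutual
    mapV-≈-refl : ∀ {σ} f (v : Val σ) → mapV f v ≈ mapV f v
    mapV-≈-refl f (vatom n) = atom≈
    mapV-≈-refl f (vabs {α} n v)
      with fresh α ((α , f α n) ∷ (α , f α n) ∷ atomsV (mapV f v) ++ atomsV (mapV f v))
    ... | c , c∉ =
      abs≈ c c∉ (subst (λ u → u ≈ u) (sym (mapV-∘ f (swap α (f α n) c) v)) (mapV-≈-refl _ v))
    mapV-≈-refl f (vtup vs) = tup≈ (mapVs-≈-refl f vs)
    mapV-≈-refl f (vinj j v) = inj≈ (mapV-≈-refl f v)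

    mapVs-≈-refl : ∀ {σs} f (vs : Vals σs) → mapVs f vs ≈s mapVs f vs
    mapVs-≈-refl f []       = []
    mapVs-≈-refl f (v ∷ vs) = mapV-≈-refl f v ∷ mapVs-≈-refl f vs

  ≈-refl : ∀ {σ} (v : Val σ) → v ≈ v
  ≈-refl v = subst (λ u → u ≈ u) (mapV-id v) (mapV-≈-refl (λ _ n → n) v)

  vabs-cong : ∀ {α σ} b {v w : Val σ} → v ≈ w → vabs {α} b v ≈ vabs b w
  vabs-cong {α} b {v} {w} v≈w with fresh α ((α , b) ∷ (α , b) ∷ atomsV v ++ atomsV w)
  ... | c , c∉ = abs≈ c c∉ (mapV-≈ (swap-injective α b c) v≈w)

  vabs-injective : ∀ {α σ b} {v w : Val σ} → vabs {α} b v ≈ vabs b w → v ≈ w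
  vabs-injective {α} {b = b} {v} {w} (abs≈ c _ bv≈bw) =
    subst₂ _≈_ (mapV-swap-involutive α b c v) (mapV-swap-involutive α b c w)
               (mapV-≈ (swap-injective α b c) bv≈bw)

  vinj-injective : ∀ {i j} {v w : Val (arity i j)} → vinj j v ≈ vinj j w → v ≈ w
  vinj-injective (inj≈ v≈w) = v≈w

  vtup-injective : ∀ {σs} {vs ws : Vals σs} → vtup vs ≈ vtup ws → vs ≈s ws
  vtup-injective (tup≈ vs≈ws) = vs≈ws

  #-vatom : ∀ {a α b} → a ≢ (α , b) → a # vatom {α} b
  #-vatom {α = α} {b} a≢b = [ (α , b) ] , (λ { (here a≡b) → a≢b a≡b }) ,
    λ π fix → subst (λ n → vatom n ≈ vatom b) (sym (fwd-fixed {π} fix (here refl))) atom≈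

  #-vinj : ∀ {i j a} {v : Val (arity i j)} → a # vinj j v ⇔ a # v
  #-vinj = mk⇔ (λ { (As , a∉ , supp) → As , a∉ , λ π fix → vinj-injective (supp π fix) })
               (λ { (As , a∉ , supp) → As , a∉ , λ π fix → inj≈ (supp π fix) })

  #-vtup-[] : ∀ {a} → a # vtup []
  #-vtup-[] = [] , (λ ()) , λ _ _ → tup≈ []

  #-vtup-∷ : ∀ {σ σs a} {v : Val σ} {vs : Vals σs} → a # vtup (v ∷ vs) ⇔ (a # v × a # vtup vs)
  #-vtup-∷ = mk⇔
    (λ { (As , a∉ , supp) → (As , a∉ , λ π fix → head-≈ (supp π fix))
                          , (As , a∉ , λ π fix → tup≈ (tail-≈ (supp π fix))) })
    (λ { ((As , a∉As , supp) , (Bs , a∉Bs , supps)) →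
         As ++ Bs , [ a∉As , a∉Bs ]′ ∘ ∈-++⁻ As , λ π fix →
         tup≈ (supp π (λ x → fix x ∘ ∈-++⁺ˡ) ∷ vtup-injective (supps π (λ x → fix x ∘ ∈-++⁺ʳ As))) })
    where
      head-≈ : ∀ {σ σs} {v w : Val σ} {vs ws : Vals σs} → vtup (v ∷ vs) ≈ vtup (w ∷ ws) → v ≈ w
      head-≈ (tup≈ (v≈w ∷ _)) = v≈w
      tail-≈ : ∀ {σ σs} {v w : Val σ} {vs ws : Vals σs} → vtup (v ∷ vs) ≈ vtup (w ∷ ws) → vs ≈s ws
      tail-≈ (tup≈ (_ ∷ vs≈ws)) = vs≈ws

  #-vabs≢ : ∀ {α σ a b} {v : Val σ} → a ≢ (α , b) → a # vabs {α} b v ⇔ a # v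
  #-vabs≢ {α} {a = a} {b} {v} a≢b = mk⇔
    (λ { (As , a∉ , supp) → (α , b) ∷ As , a∉′ a∉ , λ π fix →
         vabs-injective (subst (λ n → vabs n (π · v) ≈ vabs b v) (fwd-fixed {π} fix (here refl))
                               (supp π (λ x → fix x ∘ there))) })
    (λ { (As , a∉ , supp) → (α , b) ∷ As , a∉′ a∉ , λ π fix →
         subst (λ n → vabs n (π · v) ≈ vabs b v) (sym (fwd-fixed {π} fix (here refl)))
               (vabs-cong b (supp π (λ x → fix x ∘ there))) })
    where
      a∉′ : ∀ {As} → a ∉ As → a ∉ (α , b) ∷ As
      a∉′ a∉ (here a≡b) = a≢b a≡b
      a∉′ a∉ (there a∈) = a∉ a∈

  -- ⟨b⟩v is supported by the atoms of v other than b: if π fixes them, swapping π b in π·v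
  -- and b in v with the same fresh c gives the same body.
  #-vabs-bound : ∀ {α σ a b} {v : Val σ} → a ≡ (α , b) → a # vabs {α} b v
  #-vabs-bound {α} {b = b} {v} refl =
    others , (λ b∈ → proj₂ (∈-filter⁻ (¬? ∘ (_≟At (α , b))) {xs = atomsV v} b∈) refl) , supports
    where
      others : List Atom
      others = filter (¬? ∘ (_≟At (α , b))) (atomsV v)

      supports : Supports others (vabs {α} b v)
      supports π fix with fresh α ((α , fwd π α b) ∷ (α , b) ∷ atomsV (π · v) ++ atomsV v)
      ... | c , c∉ = abs≈ c c∉ (subst (_≈ mapV (swap α b c) v) (sym same-body) (≈-refl _))
        where
          b′ = fwd π α b

          agree : ∀ β n → (β , n) ∈ atomsV v → swap α b′ c β (fwd π β n) ≡ swap α b c β n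
          agree β n n∈ with (β , n) ≟At (α , b)
          ... | yes refl = trans (swap-left α b′ c) (sym (swap-left α b c))
          ... | no ≢b = begin
            swap α b′ c β (fwd π β n)   ≡⟨ cong (swap α b′ c β) fixed ⟩
            swap α b′ c β n             ≡⟨ swap-fixes ≢b′ ≢c ⟩
            n                           ≡⟨ swap-fixes ≢b ≢c ⟨
            swap α b c β n              ∎
            where
              open ≡-Reasoning
              fixed : fwd π β n ≡ n
              fixed = fwd-fixed {π} fix (∈-filter⁺ (¬? ∘ (_≟At (α , b))) n∈ ≢b)
              ≢b′ : (β , n) ≢ (α , b′)
              ≢b′ eq = ≢b (onAtom-injective (fwd-injective π) (trans (cong (β ,_) fixed) eq))
              ≢c : (β , n) ≢ (α , c)
              ≢c eq = c∉ (there (there (∈-++⁺ʳ (atomsV (π · v)) (subst (_∈ atomsV v) eq n∈))))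

          same-body : mapV (swap α b′ c) (π · v) ≡ mapV (swap α b c) v
          same-body = trans (mapV-∘ (fwd π) (swap α b′ c) v) (mapV-cong v agree)

  mutual
    den-cong : ∀ {σ ρ ρ′} → (∀ α n → ren ρ α n ≡ ren ρ′ α n) →
               (t : Term σ) (g g′ : Ground t) → den ρ t g ≡ den ρ′ t g′
    den-cong ρ≗ρ′ (atom {α} n)   gatom     gatom      = cong vatom (ρ≗ρ′ α n)
    den-cong ρ≗ρ′ (mod t ρ₁)     (gmod g)  (gmod g′)  = den-cong (λ α → ρ≗ρ′ α ∘ ren ρ₁ α) t g g′
    den-cong ρ≗ρ′ (abst {α} n t) (gabst g) (gabst g′) = cong₂ vabs (ρ≗ρ′ α n) (den-cong ρ≗ρ′ t g g′)
    den-cong ρ≗ρ′ (tup ts)       (gtup gs) (gtup gs′) = cong vtup (dens-cong ρ≗ρ′ ts gs gs′)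
    den-cong ρ≗ρ′ (fun j t)      (gfun g)  (gfun g′)  = cong (vinj j) (den-cong ρ≗ρ′ t g g′)

    dens-cong : ∀ {σs ρ ρ′} → (∀ α n → ren ρ α n ≡ ren ρ′ α n) →
                (ts : Terms σs) (gs gs′ : Grounds ts) → dens ρ ts gs ≡ dens ρ′ ts gs′
    dens-cong ρ≗ρ′ []       []       []         = refl
    dens-cong ρ≗ρ′ (t ∷ ts) (g ∷ gs) (g′ ∷ gs′) = cong₂ _∷_ (den-cong ρ≗ρ′ t g g′) (dens-cong ρ≗ρ′ ts gs gs′)

  module _ (φ : Subst) where

    HoldsA⇔# : ∀ {σ a} (t : Term σ) (g : Ground (φ ⟪ t ⟫)) → HoldsA φ (a ≉ t) ⇔ a # ⟦ φ ⟪ t ⟫ ⟧ g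
    HoldsA⇔# {a = a} t g =
      mk⇔ (λ h → h g) (λ h g′ → subst (a #_) (den-cong (λ _ _ → refl) (φ ⟪ t ⟫) g g′) h)

    Holds-∷ : ∀ {A ∇} → (HoldsA φ A × Holds φ ∇) ⇔ Holds φ (A ∷ ∇)
    Holds-∷ = mk⇔ (uncurry _∷_) All.uncons

    HoldsA⇔Holds-singleton : ∀ {σ σ′ a} (t : Term σ) (t′ : Term σ′)
                             (g : Ground (φ ⟪ t ⟫)) (g′ : Ground (φ ⟪ t′ ⟫)) →
                             a # ⟦ φ ⟪ t ⟫ ⟧ g ⇔ a # ⟦ φ ⟪ t′ ⟫ ⟧ g′ →
                             HoldsA φ (a ≉ t) ⇔ Holds φ [ a ≉ t′ ]
    HoldsA⇔Holds-singleton {a = a} t t′ g g′ t⇔t′ = begin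
      HoldsA φ (a ≉ t)                 ∼⟨ HoldsA⇔# t g ⟩
      a # ⟦ φ ⟪ t ⟫ ⟧ g                ∼⟨ t⇔t′ ⟩
      a # ⟦ φ ⟪ t′ ⟫ ⟧ g′              ∼⟨ ⇔.sym (HoldsA⇔# t′ g′) ⟩
      HoldsA φ (a ≉ t′)                ∼⟨ mk⇔ (_∷ []) All.head ⟩
      Holds φ [ a ≉ t′ ]               ∎
      where open EquationalReasoning

    HoldsA-tup⇔Holds-splitAll : ∀ {σs a} (ts : Terms σs) → Grounds (φ ⟪ ts ⟫s) →
                                HoldsA φ (a ≉ tup ts) ⇔ Holds φ (splitAll a ts)
    HoldsA-tup⇔Holds-splitAll []       [] = mk⇔ (λ _ → []) (λ _ → λ { (gtup []) → #-vtup-[] })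
    HoldsA-tup⇔Holds-splitAll {a = a} (t ∷ ts) (g ∷ gs) = begin
      HoldsA φ (a ≉ tup (t ∷ ts))
        ∼⟨ HoldsA⇔# (tup (t ∷ ts)) (gtup (g ∷ gs)) ⟩
      a # vtup (⟦ φ ⟪ t ⟫ ⟧ g ∷ dens ι (φ ⟪ ts ⟫s) gs)
        ∼⟨ #-vtup-∷ ⟩
      (a # ⟦ φ ⟪ t ⟫ ⟧ g × a # ⟦ φ ⟪ tup ts ⟫ ⟧ (gtup gs))
        ∼⟨ ⇔.sym (HoldsA⇔# t g ×-⇔ HoldsA⇔# (tup ts) (gtup gs)) ⟩
      (HoldsA φ (a ≉ t) × HoldsA φ (a ≉ tup ts))
        ∼⟨ ⇔.refl ×-⇔ HoldsA-tup⇔Holds-splitAll ts gs ⟩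
      (HoldsA φ (a ≉ t) × Holds φ (splitAll a ts))
        ∼⟨ Holds-∷ ⟩
      Holds φ (splitAll a (t ∷ ts))
        ∎
      where open EquationalReasoning

    HoldsA-modtup⇔Holds-modAll : ∀ {σs a ρ} (ts : Terms σs) → Grounds (φ ⟪ ts ⟫s) →
                                 HoldsA φ (a ≉ mod (tup ts) ρ) ⇔ Holds φ (modAll a ρ ts)
    HoldsA-modtup⇔Holds-modAll []       [] = mk⇔ (λ _ → []) (λ _ → λ { (gmod (gtup [])) → #-vtup-[] })
    HoldsA-modtup⇔Holds-modAll {a = a} {ρ} (t ∷ ts) (g ∷ gs) = begin
      HoldsA φ (a ≉ mod (tup (t ∷ ts)) ρ)
        ∼⟨ HoldsA⇔# (mod (tup (t ∷ ts)) ρ) (gmod (gtup (g ∷ gs))) ⟩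
      a # vtup (den (ρ ⨾ ι) (φ ⟪ t ⟫) g ∷ dens (ρ ⨾ ι) (φ ⟪ ts ⟫s) gs)
        ∼⟨ #-vtup-∷ ⟩
      (a # ⟦ φ ⟪ mod t ρ ⟫ ⟧ (gmod g) × a # ⟦ φ ⟪ mod (tup ts) ρ ⟫ ⟧ (gmod (gtup gs)))
        ∼⟨ ⇔.sym (HoldsA⇔# (mod t ρ) (gmod g) ×-⇔ HoldsA⇔# (mod (tup ts) ρ) (gmod (gtup gs))) ⟩
      (HoldsA φ (a ≉ mod t ρ) × HoldsA φ (a ≉ mod (tup ts) ρ))
        ∼⟨ ⇔.refl ×-⇔ HoldsA-modtup⇔Holds-modAll ts gs ⟩
      (HoldsA φ (a ≉ mod t ρ) × Holds φ (modAll a ρ ts))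
        ∼⟨ Holds-∷ ⟩
      Holds φ (modAll a ρ (t ∷ ts))
        ∎
      where open EquationalReasoning

    GroundOn-splitAll : ∀ {σs} a (ts : Terms σs) → Grounds (φ ⟪ ts ⟫s) → GroundOn φ (splitAll a ts)
    GroundOn-splitAll a []       []       = []
    GroundOn-splitAll a (t ∷ ts) (g ∷ gs) = g ∷ GroundOn-splitAll a ts gs

    GroundOn-modAll : ∀ {σs} a ρ (ts : Terms σs) → Grounds (φ ⟪ ts ⟫s) → GroundOn φ (modAll a ρ ts)
    GroundOn-modAll a ρ []       []       = []
    GroundOn-modAll a ρ (t ∷ ts) (g ∷ gs) = gmod g ∷ GroundOn-modAll a ρ ts gs

    ⟶-GroundOn : ∀ {A R} → A ⟶ R → GroundOn φ [ A ] → GroundOn φ R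
    ⟶-GroundOn (r-atom _)                       _                     = []
    ⟶-GroundOn r-modatom                        (gmod gatom ∷ [])     = gatom ∷ []
    ⟶-GroundOn r-modmod                         (gmod (gmod g) ∷ [])  = gmod g ∷ []
    ⟶-GroundOn r-modabs                         (gmod (gabst g) ∷ []) = gabst (gmod g) ∷ []
    ⟶-GroundOn (r-modtup {a = a} {ts = ts} {ρ}) (gmod (gtup gs) ∷ []) = GroundOn-modAll a ρ ts gs
    ⟶-GroundOn r-modfun                         (gmod (gfun g) ∷ [])  = gmod g ∷ []
    ⟶-GroundOn (r-abs≢ _)                       (gabst g ∷ [])        = g ∷ []
    ⟶-GroundOn (r-abs≡ _)                       _                     = []
    ⟶-GroundOn (r-tup {a = a} {ts = ts})        (gtup gs ∷ [])        = GroundOn-splitAll a ts gs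
    ⟶-GroundOn r-fun                            (gfun g ∷ [])         = g ∷ []

    ⟶-sound : ∀ {A R} → A ⟶ R → GroundOn φ [ A ] → HoldsA φ A ⇔ Holds φ R
    ⟶-sound (r-atom a≢b) _ = mk⇔ (λ _ → []) (λ _ → λ { gatom → #-vatom a≢b })
    ⟶-sound (r-modatom {α = α} {b} {ρ}) (gmod gatom ∷ []) =
      HoldsA⇔Holds-singleton (mod (atom b) ρ) (atom (ren ρ α b)) (gmod gatom) gatom ⇔.refl
    -- ρ₁ ⨾ (ρ ⨾ ι) and (ρ₁ ⨾ ρ) ⨾ ι agree as maps but not as records.
    ⟶-sound (r-modmod {t = t} {ρ₁} {ρ}) (gmod (gmod g) ∷ []) =
      HoldsA⇔Holds-singleton (mod (mod t ρ₁) ρ) (mod t (ρ₁ ⨾ ρ)) (gmod (gmod g)) (gmod g)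
        (≡⇒ {k = equivalence} (cong (_ #_) (den-cong (λ _ _ → refl) (φ ⟪ t ⟫) g g)))
    ⟶-sound (r-modabs {α = α} {b = b} {t} {ρ}) (gmod (gabst g) ∷ []) =
      HoldsA⇔Holds-singleton (mod (abst b t) ρ) (abst (ren ρ α b) (mod t ρ))
                             (gmod (gabst g)) (gabst (gmod g)) ⇔.refl
    ⟶-sound (r-modtup {ts = ts}) (gmod (gtup gs) ∷ []) = HoldsA-modtup⇔Holds-modAll ts gs
    ⟶-sound (r-modfun {j = j} {t} {ρ}) (gmod (gfun g) ∷ []) =
      HoldsA⇔Holds-singleton (mod (fun j t) ρ) (mod t ρ) (gmod (gfun g)) (gmod g) #-vinj
    ⟶-sound (r-abs≢ {b = b} {t} a≢b) (gabst g ∷ []) =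
      HoldsA⇔Holds-singleton (abst b t) t (gabst g) g (#-vabs≢ a≢b)
    ⟶-sound (r-abs≡ a≡b) _ = mk⇔ (λ _ → []) (λ _ → λ { (gabst _) → #-vabs-bound a≡b })
    ⟶-sound (r-tup {ts = ts}) (gtup gs ∷ []) = HoldsA-tup⇔Holds-splitAll ts gs
    ⟶-sound (r-fun {j = j} {t}) (gfun g ∷ []) = HoldsA⇔Holds-singleton (fun j t) t (gfun g) g #-vinj

    ⇒-GroundOn : ∀ {∇ ∇′} → ∇ ⇒ ∇′ → GroundOn φ ∇ → GroundOn φ ∇′
    ⇒-GroundOn (step ∇₁ _ r) = All-replace ∇₁ (⟶-GroundOn r ∘ (_∷ []))

    ⇒-sound : ∀ {∇ ∇′} → ∇ ⇒ ∇′ → GroundOn φ ∇ → Holds φ ∇ ⇔ Holds φ ∇′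
    ⇒-sound (step ∇₁ {R = R} _ r) G =
      mk⇔ (All-replace ∇₁ (Equivalence.to A⇔R)) (All-replace⁻ ∇₁ R (Equivalence.from A⇔R))
      where A⇔R = ⟶-sound r (All.head (AllP.++⁻ʳ ∇₁ G) ∷ [])

    ⇒*-sound : ∀ {∇ ∇′} → Star _⇒_ ∇ ∇′ → GroundOn φ ∇ → Holds φ ∇ ⇔ Holds φ ∇′
    ⇒*-sound ε         _ = ⇔.refl
    ⇒*-sound (s ◅ ss) G = ⇔.trans (⇒-sound s G) (⇒*-sound ss (⇒-GroundOn s G))

    HoldsA⇔HoldsA-tildeT : ∀ {σ} a (t : Term σ) → HoldsA φ (a ≉ t) ⇔ HoldsA φ (a ≉ tildeT t)
    HoldsA⇔HoldsA-tildeT a (var {σ} x) =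
      mk⇔ (λ h → λ { (gmod g) → subst (a #_) (den-cong (λ _ _ → refl) (sub φ σ x) g g) (h g) })
          (λ h g → subst (a #_) (den-cong (λ _ _ → refl) (sub φ σ x) g g) (h (gmod g)))
    HoldsA⇔HoldsA-tildeT a (atom _)   = ⇔.refl
    HoldsA⇔HoldsA-tildeT a (mod _ _)  = ⇔.refl
    HoldsA⇔HoldsA-tildeT a (abst _ _) = ⇔.refl
    HoldsA⇔HoldsA-tildeT a (tup _)    = ⇔.refl
    HoldsA⇔HoldsA-tildeT a (fun _ _)  = ⇔.refl

    Holds⇔Holds-tilde : ∀ ∇ → Holds φ ∇ ⇔ Holds φ (tilde ∇)
    Holds⇔Holds-tilde ∇ = mk⇔
      (AllP.map⁺ ∘ All.map λ { {a ≉ t} → Equivalence.to (HoldsA⇔HoldsA-tildeT a t) })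
      (All.map (λ { {a ≉ t} → Equivalence.from (HoldsA⇔HoldsA-tildeT a t) }) ∘ AllP.map⁻)

open Nominal using (FEnv; Subst; IsGroundSubst; GroundOn; IsNF; Holds; tilde)

lemma5p7 : (S : Signature) (∇ : FEnv S) (φ : Subst S) →
    IsGroundSubst S φ → GroundOn S φ ∇ →
    (N : FEnv S) → IsNF S ∇ N →
    (Holds S φ ∇ ⇔ Holds S φ N) × (Holds S φ N ⇔ Holds S φ (tilde S N))
lemma5p7 S ∇ φ _ G N (∇⇒*N , _) = ⇒*-sound S φ ∇⇒*N G , Holds⇔Holds-tilde S φ N
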